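{- Let $u^{(1)},\dots,u^{(k)}$ ($k\ge1$) and $\beta^{(1)},\dots,\beta^{(m)}$ ($m\ge1$) be integer intervals in $[1,n]$, let $I=\bigcap_{i}v_{u^{(i)}}$, $I_{maxl}=\max_i u^{(i)}_l$, $I_{minr}=\min_i u^{(i)}_r$, $D=\bigcup_j v_{\beta^{(j)}}$, and let $D_r$ be the file of the rightmost square of $D$. Let $\rho=I\setminus D$ and let $u=[u_l,u_r]\subseteq[1,n]$ be an interval such that all $u^{(i)}$ and all $\beta^{(j)}$ have left endpoint at most $u_l$. If $v_u\cap\rho\neq\emptyset$, then $v_u\cap\rho=v_{[u_l,\min(I_{minr},u_r)]}\setminus v_{[u_l,D_r]}$ (with $v$ of an empty interval being the empty set).
   Context: Board: $n\times n$, files and ranks numbered $1,\dots,n$. A pawn-square is a square $s$ at file $f$, rank $r$ with $2\le r\le n-1$; its set of potential starting files is $\mu_s=\{g\in\mathbb{Z}:\max(1,f-(r-2))\le g\le\min(n,f+(r-2))\}$. For an integer interval $u\subseteq[1,n]$, $v_u$ is the set of pawn-squares $s$ with $\mu_s\subseteq u$. Intervals are processed in lexicographic order of (left endpoint, right endpoint), and $u$ is processed after all the $u^{(i)}$ and $\beta^{(j)}$. -}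

module Defs where

open import Data.Nat using (ℕ; _+_; _∸_; _≤_; _⊔_; _⊓_)
open import Data.Product using (_×_; Σ; ∃; _,_)
open import Data.Fin using (Fin)
open import Data.Vec using (Vec; lookup; map; foldr₁)
open import Relation.Binary.PropositionalEquality using (_≡_)

record Square : Set where
  constructor sq
  field
    file : ℕ
    rank : ℕ
open Square public

PawnSquare : ℕ → Square → Set
PawnSquare n s = (1 ≤ file s) × (file s ≤ n) × (2 ≤ rank s) × (rank s + 1 ≤ n)

muL : Square → ℕ
muL s = 1 ⊔ (file s ∸ (rank s ∸ 2))

muR : ℕ → Square → ℕ
muR n s = n ⊓ (file s + (rank s ∸ 2))

-- v_[a,b] : pawn-squares s with μ_s ⊆ [a,b] (empty when a > b, since muL ≤ muR).
V : ℕ → ℕ → ℕ → Square → Set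
V n a b s = PawnSquare n s × (a ≤ muL s) × (muR n s ≤ b)

record Interval (n : ℕ) : Set where
  constructor ⟦_,_⟧⟨_,_,_⟩
  field
    l : ℕ
    r : ℕ
    1≤l : 1 ≤ l
    l≤r : l ≤ r
    r≤n : r ≤ n
open Interval public

v : ∀ {n} → Interval n → Square → Set
v {n} u = V n (l u) (r u)

Inter : ∀ {n k} → Vec (Interval n) k → Square → Set
Inter us s = ∀ i → v (lookup us i) s

Union : ∀ {n m} → Vec (Interval n) m → Square → Set
Union bs s = ∃ λ j → v (lookup bs j) s

Iminr : ∀ {n k} → Vec (Interval n) (Data.Nat.suc k) → ℕ
Iminr us = foldr₁ _⊓_ (map r us)

IsRightmostFile : (Square → Set) → ℕ → Set
IsRightmostFile D d = (∃ λ s → D s × file s ≡ d) × (∀ s → D s → file s ≤ d)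

{-# OPTIONS --safe #-}
module Submission where

open import Defs
open import Data.Nat using (ℕ; suc; _≤_; _⊓_)
open import Data.Nat.Properties
open import Data.Product using (_×_; ∃; _,_; proj₂)
open import Data.Fin using (zero; suc)
open import Data.Vec using (Vec; lookup; []; _∷_; map; foldr₁)
open import Data.Vec.Properties using (lookup-map)
open import Relation.Nullary using (¬_)
open import Function.Bundles using (_⇔_; mk⇔; Equivalence)
open import Relation.Binary.PropositionalEquality using (sym; subst)

-- Let a bound every left endpoint l u_i and l β_j.  For a pawn-square s with a ≤ muL s,
-- membership in I and in D depends only on muR s: s ∈ I iff muR s ≤ I_minr, and s ∈ D iff
-- muR s ≤ D_r, because D_r = max_j r β_j (the rank-2 square on file r β_j has μ = {r β_j}).
-- With a = l u both sides of the equivalence therefore say l u ≤ muL s,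
-- muR s ≤ min(I_minr, r u) and D_r < muR s.

foldr₁-⊓≤lookup : ∀ {k} (xs : Vec ℕ (suc k)) i → foldr₁ _⊓_ xs ≤ lookup xs i
foldr₁-⊓≤lookup (x ∷ [])     zero    = ≤-refl
foldr₁-⊓≤lookup (x ∷ y ∷ xs) zero    = m⊓n≤m x _
foldr₁-⊓≤lookup (x ∷ y ∷ xs) (suc i) = ≤-trans (m⊓n≤n x _) (foldr₁-⊓≤lookup (y ∷ xs) i)

≤foldr₁-⊓ : ∀ {k a} (xs : Vec ℕ (suc k)) → (∀ i → a ≤ lookup xs i) → a ≤ foldr₁ _⊓_ xs
≤foldr₁-⊓ (x ∷ [])     a≤ = a≤ zero
≤foldr₁-⊓ (x ∷ y ∷ xs) a≤ = ⊓-glb (a≤ zero) (≤foldr₁-⊓ (y ∷ xs) (λ i → a≤ (suc i)))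

Iminr≤r : ∀ {n k} (us : Vec (Interval n) (suc k)) i → Iminr us ≤ r (lookup us i)
Iminr≤r us i = subst (Iminr us ≤_) (lookup-map i r us) (foldr₁-⊓≤lookup (map r us) i)

≤Iminr : ∀ {n k a} (us : Vec (Interval n) (suc k)) → (∀ i → a ≤ r (lookup us i)) → a ≤ Iminr us
≤Iminr us a≤ = ≤foldr₁-⊓ (map r us) (λ i → subst (_ ≤_) (sym (lookup-map i r us)) (a≤ i))

file≤muR : ∀ {n s} → PawnSquare n s → file s ≤ muR n s
file≤muR (_ , file≤n , _) = ⊓-glb file≤n (m≤m+n _ _)

PawnSquare⇒3≤n : ∀ {n s} → PawnSquare n s → 3 ≤ n
PawnSquare⇒3≤n (_ , _ , 2≤rank , rank+1≤n) = ≤-trans (+-monoˡ-≤ 1 2≤rank) rank+1≤n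

rightEdgeSquare∈v : ∀ {n} (β : Interval n) → 3 ≤ n → v β (sq (r β) 2)
rightEdgeSquare∈v β 3≤n =
  (≤-trans (1≤l β) (l≤r β) , r≤n β , ≤-refl , 3≤n) ,
  ≤-trans (l≤r β) (m≤n⊔m 1 (r β)) ,
  ≤-trans (m⊓n≤n _ _) (≤-reflexive (+-identityʳ (r β)))

rightmostFile≤r : ∀ {n m Dr} (βs : Vec (Interval n) m) → IsRightmostFile (Union βs) Dr →
                  ∃ λ j → Dr ≤ r (lookup βs j)
rightmostFile≤r βs ((t , (j , t∈P , _ , muR≤r) , file≡Dr) , _) =
  j , subst (_≤ _) file≡Dr (≤-trans (file≤muR t∈P) muR≤r)

r≤rightmostFile : ∀ {n m Dr} (βs : Vec (Interval n) m) → IsRightmostFile (Union βs) Dr →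
                  3 ≤ n → ∀ j → r (lookup βs j) ≤ Dr
r≤rightmostFile βs (_ , rightmost) 3≤n j =
  rightmost (sq _ 2) (j , rightEdgeSquare∈v (lookup βs j) 3≤n)

Inter⇔muR≤Iminr : ∀ {n k a s} (us : Vec (Interval n) (suc k)) → (∀ i → l (lookup us i) ≤ a) →
                  PawnSquare n s → a ≤ muL s → Inter us s ⇔ muR n s ≤ Iminr us
Inter⇔muR≤Iminr us l≤a s∈P a≤muL = mk⇔
  (λ s∈I → ≤Iminr us (λ i → proj₂ (proj₂ (s∈I i))))
  (λ muR≤Iminr i → s∈P , ≤-trans (l≤a i) a≤muL , ≤-trans muR≤Iminr (Iminr≤r us i))

Union⇔muR≤rightmostFile : ∀ {n m a s Dr} (βs : Vec (Interval n) m) →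
                          IsRightmostFile (Union βs) Dr → (∀ j → l (lookup βs j) ≤ a) →
                          PawnSquare n s → a ≤ muL s → Union βs s ⇔ muR n s ≤ Dr
Union⇔muR≤rightmostFile βs Dr-rightmost l≤a s∈P a≤muL = mk⇔
  (λ (j , _ , _ , muR≤r) → ≤-trans muR≤r (r≤rightmostFile βs Dr-rightmost (PawnSquare⇒3≤n s∈P) j))
  (λ muR≤Dr → let (j , Dr≤r) = rightmostFile≤r βs Dr-rightmost in
              j , s∈P , ≤-trans (l≤a j) a≤muL , ≤-trans muR≤Dr Dr≤r)

lemma5 : (n k m : ℕ) (us : Vec (Interval n) (suc k)) (βs : Vec (Interval n) (suc m))
    → (Dr : ℕ) → IsRightmostFile (Union βs) Dr
    → (u : Interval n)
    → (∀ i → l (lookup us i) ≤ l u)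
    → (∀ j → l (lookup βs j) ≤ l u)
    → (∃ λ s → v u s × (Inter us s × ¬ Union βs s))
    → ∀ s → (v u s × (Inter us s × ¬ Union βs s))
              ⇔ (V n (l u) (Iminr us ⊓ r u) s × ¬ V n (l u) Dr s)
lemma5 n k m us βs Dr Dr-rightmost u us≤u βs≤u _ s = mk⇔
  (λ ((s∈P , l≤muL , muR≤r) , s∈I , s∉D) →
     (s∈P , l≤muL , ⊓-glb (I.to s∈P l≤muL s∈I) muR≤r) ,
     λ (_ , _ , muR≤Dr) → s∉D (D.from s∈P l≤muL muR≤Dr))
  (λ ((s∈P , l≤muL , muR≤min) , s∉V) →
     (s∈P , l≤muL , ≤-trans muR≤min (m⊓n≤n _ _)) ,
     I.from s∈P l≤muL (≤-trans muR≤min (m⊓n≤m _ _)) ,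
     λ s∈D → s∉V (s∈P , l≤muL , D.to s∈P l≤muL s∈D))
  where
    module I s∈P l≤muL = Equivalence (Inter⇔muR≤Iminr {s = s} us us≤u s∈P l≤muL)
    module D s∈P l≤muL = Equivalence (Union⇔muR≤rightmostFile {s = s} βs Dr-rightmost βs≤u s∈P l≤muL)
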